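{- Let $k\geq1$, let $G_i=(V_i,E_i)$ ($1\le i\le k$) and $H=(V_H,E_H)$ be pairwise vertex-disjoint, connected graphs, each with at least two vertices, let $u_i\in V_i$ and $v_1,\dots,v_k\in V_H$ (not necessarily distinct), and let $J=G_{1,\ldots,k}\circ^{u_1,\dots,u_k}_{v_1,\dots,v_k}H$. Then for every $w\in V_H$, $$\mathrm{MD}_J(w)=\bigl(\mathrm{MD}_H(w)\setminus\{v_1,\dots,v_k\}\bigr)\cup\bigcup_{1\le i\le k}\mathrm{MD}_{G_i}(u_i).$$
   Context: All graphs are finite, undirected and simple. In a connected graph $G$, $d_G(x,y)$ is the distance and $N_G(x)$ the set of neighbours of $x$. A vertex $u$ is maximally distant from a vertex $w$ in $G$ if there is no $v\in N_G(u)$ with $d_G(v,w)>d_G(u,w)$. $\mathrm{MD}_G(u)$ denotes the set of vertices of $G$ that are maximally distant from $u$ in $G$. The composed graph $J=G_{1,\ldots,k}\circ^{u_1,\dots,u_k}_{v_1,\dots,v_k}H$ has vertex set $(V_1\cup\dots\cup V_k\cup V_H)\setminus\{u_1,\dots,u_k\}$ and edge set $(E_1\cup\dots\cup E_k\cup E_H\cup\{\{x,v_i\}: x\in N_{G_i}(u_i),1\le i\le k\})\setminus\{\{x,u_i\}: x\in N_{G_i}(u_i),1\le i\le k\}$; i.e. $J$ is obtained by identifying each $u_i$ with $v_i$. -}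

module Defs where

open import Data.Nat using (ℕ; zero; suc; _≤_; _<_)
open import Data.Fin using (Fin)
open import Data.Product using (Σ; Σ-syntax; ∃; _×_; _,_)
open import Data.Sum using (_⊎_; inj₁; inj₂)
open import Relation.Nullary using (¬_)
open import Relation.Binary.PropositionalEquality using (_≡_; _≢_)

record Graph (V : Set) : Set₁ where
  field
    Adj   : V → V → Set
    sym   : ∀ {x y} → Adj x y → Adj y x
    irrefl : ∀ {x} → ¬ Adj x x
open Graph public

module _ {V : Set} (Adj : V → V → Set) where

  data Walk : V → V → ℕ → Set where
    here : ∀ {x} → Walk x x 0
    step : ∀ {x y z l} → Adj x y → Walk y z l → Walk x z (suc l)

  Connected : Set
  Connected = ∀ x y → ∃ λ l → Walk x y l

  Dist : V → V → ℕ → Set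
  Dist x y d = Walk x y d × (∀ l → Walk x y l → d ≤ l)

  MD : V → V → Set
  MD w u = ¬ (Σ[ v ∈ V ] Σ[ dv ∈ ℕ ] Σ[ du ∈ ℕ ]
               (Adj u v × Dist v w dv × Dist u w du × du < dv))

module Compose {k : ℕ} {n : Fin k → ℕ} {m : ℕ}
               (G : (i : Fin k) → Graph (Fin (n i))) (H : Graph (Fin m))
               (u : (i : Fin k) → Fin (n i)) (v : Fin k → Fin m) where

  -- vertices: (V_1 ∪ … ∪ V_k ∪ V_H) \ {u_1,…,u_k}, disjointly
  JV : Set
  JV = (Σ[ i ∈ Fin k ] Σ[ x ∈ Fin (n i) ] x ≢ u i) ⊎ Fin m

  data JAdj : JV → JV → Set where
    gg : ∀ i {x y} (px : x ≢ u i) (py : y ≢ u i) →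
         Adj (G i) x y → JAdj (inj₁ (i , x , px)) (inj₁ (i , y , py))
    hh : ∀ {a b} → Adj H a b → JAdj (inj₂ a) (inj₂ b)
    gh : ∀ i {x} (px : x ≢ u i) →
         Adj (G i) x (u i) → JAdj (inj₁ (i , x , px)) (inj₂ (v i))
    hg : ∀ i {x} (px : x ≢ u i) →
         Adj (G i) x (u i) → JAdj (inj₂ (v i)) (inj₁ (i , x , px))

  RHS : Fin m → JV → Set
  RHS w (inj₁ (i , x , _)) = MD (Adj (G i)) (u i) x
  RHS w (inj₂ h) = MD (Adj H) w h × (∀ i → h ≢ v i)

{-# OPTIONS --safe #-}
module Submission where

-- A shortest walk in J from a vertex of H to w stays in H, and one from a vertex x of G_i
-- to w runs inside G_i to u_i and then inside H from v_i to w.  So distances to w are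
-- d_H(h, w) on H and d_{G_i}(x, u_i) + d_H(v_i, w) on G_i - u_i, and the maximally distant
-- vertices can be read off neighbour by neighbour.  The one new effect is at v_i: it has a
-- neighbour in G_i farther from w, so it is never maximally distant in J.  Distances only
-- exist up to double negation, which suffices because every goal is a negation.

open import Defs
open import Data.Nat using (ℕ; suc; _≤_; _<_; _+_; z≤n; s≤s; _<?_)
open import Data.Nat.Properties
  using (≤-antisym; ≤-trans; ≤-refl; ≮⇒≥; m≤n+m; m≤n⇒m≤1+n; +-mono-≤;
         +-cancelʳ-<; +-monoˡ-<; n≮0; m+n≮n)
open import Data.Nat.Induction using (<-rec)
open import Data.Fin using (Fin; _≟_; punchIn) renaming (zero to fzero)
open import Data.Fin.Properties using (punchInᵢ≢i)
open import Data.Sum using (inj₁; inj₂)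
open import Data.Product using (∃; ∃₂; _×_; _,_)
open import Data.Empty using (⊥; ⊥-elim)
open import Relation.Nullary using (¬_; yes; no)
open import Relation.Binary.PropositionalEquality using (_≡_; _≢_; refl; subst)
open import Function.Bundles using (_⇔_; mk⇔)

¬¬-least : (P : ℕ → Set) → ∀ n → P n → ¬ ¬ ∃ λ m → P m × (∀ l → P l → m ≤ l)
¬¬-least P n pn noLeast = <-rec (λ n → ¬ P n) least-below n pn
  where
  least-below : ∀ n → (∀ {l} → l < n → ¬ P l) → ¬ P n
  least-below n below pn = noLeast (n , pn , bound)
    where
    bound : ∀ l → P l → n ≤ l
    bound l pl with l <? n
    ... | yes l<n = ⊥-elim (below l<n pl)
    ... | no l≮n = ≮⇒≥ l≮n

Fin-other : ∀ {n} → 2 ≤ n → (a : Fin n) → ∃ λ b → b ≢ a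
Fin-other (s≤s (s≤s z≤n)) a = punchIn a fzero , punchInᵢ≢i a fzero

module _ {V : Set} {A : V → V → Set} where

  _++ʷ_ : ∀ {x y z a b} → Walk A x y a → Walk A y z b → Walk A x z (a + b)
  here ++ʷ q = q
  step e p ++ʷ q = step e (p ++ʷ q)

  Dist-functional : ∀ {x y d d′} → Dist A x y d → Dist A x y d′ → d ≡ d′
  Dist-functional (p , min) (p′ , min′) = ≤-antisym (min _ p′) (min′ _ p)

  Dist-refl : ∀ x → Dist A x x 0
  Dist-refl x = here , λ _ _ → z≤n

  Dist-adjacent : ∀ {x y} → x ≢ y → A x y → Dist A x y 1
  Dist-adjacent {x} {y} x≢y e = step e here , nonempty
    where
    nonempty : ∀ l → Walk A x y l → 1 ≤ l
    nonempty .0 here = ⊥-elim (x≢y refl)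
    nonempty .(suc _) (step _ _) = s≤s z≤n

  Dist-squeeze : ∀ {x y l d} → Walk A x y l → l ≤ d → (∀ l′ → Walk A x y l′ → d ≤ l′) →
                 Dist A x y d
  Dist-squeeze {x} {y} p l≤d lower =
    subst (Walk A x y) (≤-antisym l≤d (lower _ p)) p , lower

  connected⇒¬¬Dist : Connected A → ∀ x y → ¬ ¬ ∃ (Dist A x y)
  connected⇒¬¬Dist conn x y with conn x y
  ... | l , p = ¬¬-least (Walk A x y) l p

  connected⇒neighbour : Connected A → ∀ {x y} → y ≢ x → ∃ (A x)
  connected⇒neighbour conn {x} {y} y≢x with conn x y
  ... | .0 , here = ⊥-elim (y≢x refl)
  ... | .(suc _) , step {y = z} e _ = z , e

module Composition {k : ℕ} {n : Fin k → ℕ} {m : ℕ}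
                   (G : (i : Fin k) → Graph (Fin (n i))) (H : Graph (Fin m))
                   (u : (i : Fin k) → Fin (n i)) (v : Fin k → Fin m) where
  open Compose G H u v

  walkᴴ : ∀ {a b l} → Walk (Adj H) a b l → Walk JAdj (inj₂ a) (inj₂ b) l
  walkᴴ here = here
  walkᴴ (step e p) = step (hh e) (walkᴴ p)

  -- Cut at the first visit of u_i, hence possibly shorter than the G_i-walk.
  walkᴳ : ∀ i {x a} (px : x ≢ u i) → Walk (Adj (G i)) x (u i) a →
          ∃ λ a′ → a′ ≤ a × Walk JAdj (inj₁ (i , x , px)) (inj₂ (v i)) a′
  walkᴳ i px here = ⊥-elim (px refl)
  walkᴳ i px (step {y = y} e p) with y ≟ u i
  ... | yes refl = 1 , s≤s z≤n , step (gh i px e) here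
  ... | no py with walkᴳ i py p
  ... | a′ , a′≤a , q = suc a′ , s≤s a′≤a , step (gg i px py e) q

  mutual
    projectᴴ : ∀ {h w l} → Walk JAdj (inj₂ h) (inj₂ w) l →
               ∃ λ l′ → Walk (Adj H) h w l′ × l′ ≤ l
    projectᴴ here = 0 , here , z≤n
    projectᴴ (step (hh e) p) with projectᴴ p
    ... | l′ , q , l′≤l = suc l′ , step e q , s≤s l′≤l
    projectᴴ (step (hg i px e) p) with projectᴳ p
    ... | a , b , _ , q , a+b≤l = b , q , ≤-trans (m≤n+m b a) (m≤n⇒m≤1+n a+b≤l)

    projectᴳ : ∀ {i x w l} {px : x ≢ u i} → Walk JAdj (inj₁ (i , x , px)) (inj₂ w) l →
               ∃₂ λ a b → Walk (Adj (G i)) x (u i) a × Walk (Adj H) (v i) w b × a + b ≤ l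
    projectᴳ (step (gg i px py e) p) with projectᴳ p
    ... | a , b , q , r , a+b≤l = suc a , b , step e q , r , s≤s a+b≤l
    projectᴳ (step (gh i px e) p) with projectᴴ p
    ... | b , r , b≤l = 1 , b , step e here , r , s≤s b≤l

  Dist-inj₂ : ∀ {h w d} → Dist (Adj H) h w d → Dist JAdj (inj₂ h) (inj₂ w) d
  Dist-inj₂ {h} {w} {d} (p , min) = walkᴴ p , lower
    where
    lower : ∀ l → Walk JAdj (inj₂ h) (inj₂ w) l → d ≤ l
    lower l q with projectᴴ q
    ... | l′ , q′ , l′≤l = ≤-trans (min l′ q′) l′≤l

  Dist-inj₁ : ∀ {i x w a b} (px : x ≢ u i) →
              Dist (Adj (G i)) x (u i) a → Dist (Adj H) (v i) w b →
              Dist JAdj (inj₁ (i , x , px)) (inj₂ w) (a + b)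
  Dist-inj₁ {i} {x} {w} {a} {b} px (p , minᴳ) (q , minᴴ) with walkᴳ i px p
  ... | a′ , a′≤a , p′ = Dist-squeeze (p′ ++ʷ walkᴴ q) (+-mono-≤ a′≤a ≤-refl) lower
    where
    lower : ∀ l → Walk JAdj (inj₁ (i , x , px)) (inj₂ w) l → a + b ≤ l
    lower l r with projectᴳ r
    ... | a″ , b″ , p″ , q″ , a″+b″≤l = ≤-trans (+-mono-≤ (minᴳ a″ p″) (minᴴ b″ q″)) a″+b″≤l

  module _ (n≥2 : ∀ i → 2 ≤ n i) (connᴳ : ∀ i → Connected (Adj (G i)))
           (connᴴ : Connected (Adj H)) (w : Fin m) where

    Dist-inj₂⁻¹ : ∀ {h d} → Dist JAdj (inj₂ h) (inj₂ w) d → ¬ ¬ Dist (Adj H) h w d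
    Dist-inj₂⁻¹ {h} D ¬D = connected⇒¬¬Dist connᴴ h w λ (d′ , D′) →
      ¬D (subst (Dist (Adj H) h w) (Dist-functional (Dist-inj₂ D′) D) D′)

    Dist-inj₁⁻¹ : ∀ {i x b d} (px : x ≢ u i) → Dist (Adj H) (v i) w b →
                  Dist JAdj (inj₁ (i , x , px)) (inj₂ w) d →
                  ¬ ¬ ∃ λ a → Dist (Adj (G i)) x (u i) a × a + b ≡ d
    Dist-inj₁⁻¹ {i} {x} px Db D ¬D = connected⇒¬¬Dist (connᴳ i) x (u i) λ (a , Da) →
      ¬D (a , Da , Dist-functional (Dist-inj₁ px Da Db) D)

    neighbourOfRoot : ∀ i → ∃ λ y → y ≢ u i × Adj (G i) y (u i)
    neighbourOfRoot i with Fin-other (n≥2 i) (u i)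
    ... | y , y≢u with connected⇒neighbour (connᴳ i) y≢u
    ... | z , e = z , (λ { refl → irrefl (G i) e }) , Graph.sym (G i) e

    MD⇒MDᴴ : ∀ {h} → MD JAdj (inj₂ w) (inj₂ h) → MD (Adj H) w h
    MD⇒MDᴴ md (y , dy , dh , e , Dy , Dh , lt) =
      md (inj₂ y , dy , dh , hh e , Dist-inj₂ Dy , Dist-inj₂ Dh , lt)

    ¬MD-glued : ∀ i → ¬ MD JAdj (inj₂ w) (inj₂ (v i))
    ¬MD-glued i md with neighbourOfRoot i
    ... | y , py , e = connected⇒¬¬Dist connᴴ (v i) w λ (b , Db) →
      md (inj₁ (i , y , py) , 1 + b , b , hg i py e ,
          Dist-inj₁ py (Dist-adjacent py e) Db , Dist-inj₂ Db , ≤-refl)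

    MDᴴ⇒MD : ∀ {h} → MD (Adj H) w h → (∀ i → h ≢ v i) → MD JAdj (inj₂ w) (inj₂ h)
    MDᴴ⇒MD mdᴴ _ (inj₂ y , dy , dh , hh e , Dy , Dh , lt) =
      Dist-inj₂⁻¹ Dy λ Dy′ → Dist-inj₂⁻¹ Dh λ Dh′ → mdᴴ (y , dy , dh , e , Dy′ , Dh′ , lt)
    MDᴴ⇒MD _ unglued (inj₁ _ , _ , _ , hg i _ _ , _) = unglued i refl

    MD⇒MDᴳ : ∀ {i x} (px : x ≢ u i) → MD JAdj (inj₂ w) (inj₁ (i , x , px)) →
             MD (Adj (G i)) (u i) x
    MD⇒MDᴳ {i} px md (y , dy , dx , e , Dy , Dx , lt) with y ≟ u i
    ... | yes refl = n≮0 (subst (dx <_) (Dist-functional Dy (Dist-refl (u i))) lt)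
    ... | no py = connected⇒¬¬Dist connᴴ (v i) w λ (b , Db) →
      md (inj₁ (i , y , py) , dy + b , dx + b , gg i px py e ,
          Dist-inj₁ py Dy Db , Dist-inj₁ px Dx Db , +-monoˡ-< b lt)

    MDᴳ⇒MD : ∀ {i x} (px : x ≢ u i) → MD (Adj (G i)) (u i) x →
             MD JAdj (inj₂ w) (inj₁ (i , x , px))
    MDᴳ⇒MD {i} {x} px mdᴳ (y , dy , dx , e , Dy , Dx , lt) =
      connected⇒¬¬Dist connᴴ (v i) w λ (b , Db) →
      Dist-inj₁⁻¹ px Db Dx λ { (a , Da , refl) → farther Db Da e Dy lt }
      where
      farther : ∀ {b a y dy} → Dist (Adj H) (v i) w b → Dist (Adj (G i)) x (u i) a →
                JAdj (inj₁ (i , x , px)) y → Dist JAdj y (inj₂ w) dy → a + b < dy → ⊥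
      farther Db Da (gg _ _ py e) Dy lt =
        Dist-inj₁⁻¹ py Db Dy λ { (c , Dc , refl) →
          mdᴳ (_ , c , _ , e , Dc , Da , +-cancelʳ-< _ _ c lt) }
      farther {b} {a} Db Da (gh _ _ _) Dy lt =
        m+n≮n a b (subst (a + b <_) (Dist-functional Dy (Dist-inj₂ Db)) lt)

    MD⇔RHS : ∀ x → MD JAdj (inj₂ w) x ⇔ RHS w x
    MD⇔RHS (inj₁ (i , x , px)) = mk⇔ (MD⇒MDᴳ px) (MDᴳ⇒MD px)
    MD⇔RHS (inj₂ h) = mk⇔ (λ md → MD⇒MDᴴ md , λ { i refl → ¬MD-glued i md })
                          (λ (mdᴴ , unglued) → MDᴴ⇒MD mdᴴ unglued)

lemma2 : (k : ℕ) → 1 ≤ k → (n : Fin k → ℕ) → (m : ℕ)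
    → (G : (i : Fin k) → Graph (Fin (n i))) → (H : Graph (Fin m))
    → (∀ i → 2 ≤ n i) → 2 ≤ m
    → (∀ i → Connected (Adj (G i))) → Connected (Adj H)
    → (u : (i : Fin k) → Fin (n i)) → (v : Fin k → Fin m)
    → (w : Fin m) → (x : Compose.JV G H u v)
    → MD (Compose.JAdj G H u v) (inj₂ w) x ⇔ Compose.RHS G H u v w x
lemma2 k _ n m G H n≥2 _ connᴳ connᴴ u v w =
  Composition.MD⇔RHS G H u v n≥2 connᴳ connᴴ w
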